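{- Let $I$ be a stable matching instance of size $n$ with $\mathrm{range}(I)\le k$. Then each agent in $I$ has at most $5 k - 4$ stable partners. In particular, each agent can appear in at most $5 k - 5$ rotations.
   Context: For a stable matching instance $I$ with complete preferences ($n$ men, $n$ women), $\min\mathrm{rank}(a)$ and $\max\mathrm{rank}(a)$ are the minimum and maximum rank agent $a$ receives in the preference lists of agents of the opposite sex, and $\mathrm{range}(I)=\max_a(\max\mathrm{rank}(a)-\min\mathrm{rank}(a))+1$. A stable partner of $a$ is an agent matched to $a$ in some stable matching. -}

module Defs where

open import Data.Nat using (ℕ; _<_; _≤_; _⊔_; _⊓_; _+_; _∸_; _*_)
open import Data.Fin using (Fin; toℕ)
open import Data.List using (List; []; _∷_; map; foldr; allFin; _++_; [_]; zip; drop; take; length)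
open import Data.List.Relation.Unary.All using (All)
open import Data.List.Relation.Unary.Unique.Propositional using (Unique)
open import Data.List.Membership.Propositional using (_∈_)
open import Data.Product using (Σ; ∃; ∃-syntax; _×_; _,_; proj₁; proj₂)
open import Function.Definitions using (Injective)
open import Relation.Binary.PropositionalEquality using (_≡_)
open import Relation.Nullary using (¬_)

-- A stable matching instance of size n with complete strict preferences.
-- rankM m w = position (0-based) of woman w in man m's list;
-- rankW w m = position (0-based) of man m in woman w's list.
-- Injectivity in the second argument = strict, complete list (a permutation).
record Instance (n : ℕ) : Set where
  field
    rankM    : Fin n → Fin n → Fin n
    rankW    : Fin n → Fin n → Fin n
    rankM-inj : ∀ m → Injective _≡_ _≡_ (rankM m)
    rankW-inj : ∀ w → Injective _≡_ _≡_ (rankW w)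

module _ {n : ℕ} (I : Instance n) where
  open Instance I

  -- maximum / minimum of a list of ranks (ranks are < n, so n is a neutral start for min)
  maxL : List ℕ → ℕ
  maxL = foldr _⊔_ 0

  minL : List ℕ → ℕ
  minL = foldr _⊓_ n

  ranksOfMan : Fin n → List ℕ
  ranksOfMan m = map (λ w → toℕ (rankW w m)) (allFin n)

  ranksOfWoman : Fin n → List ℕ
  ranksOfWoman w = map (λ m → toℕ (rankM m w)) (allFin n)

  maxRankM minRankM : Fin n → ℕ
  maxRankM m = maxL (ranksOfMan m)
  minRankM m = minL (ranksOfMan m)

  maxRankW minRankW : Fin n → ℕ
  maxRankW w = maxL (ranksOfWoman w)
  minRankW w = minL (ranksOfWoman w)

  range : ℕ
  range = maxL (map (λ m → maxRankM m ∸ minRankM m) (allFin n)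
             ++ map (λ w → maxRankW w ∸ minRankW w) (allFin n)) + 1

  record Matching : Set where
    field
      μ     : Fin n → Fin n
      μ-inj : Injective _≡_ _≡_ μ
  open Matching public

  Blocking : Matching → Fin n → Fin n → Set
  Blocking M m w =
    toℕ (rankM m w) < toℕ (rankM m (μ M m)) ×
    (∀ m' → μ M m' ≡ w → toℕ (rankW w m) < toℕ (rankW w m'))

  Stable : Matching → Set
  Stable M = ∀ m w → ¬ Blocking M m w

  StablePartner : Fin n → Fin n → Set
  StablePartner m w = Σ Matching λ M → Stable M × μ M m ≡ w

  PrefersW : Matching → Fin n → Fin n → Set
  PrefersW M w m = ∀ m' → μ M m' ≡ w → toℕ (rankW w m) < toℕ (rankW w m')

  IsNext : Matching → Fin n → Fin n → Set
  IsNext M m w =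
    toℕ (rankM m (μ M m)) < toℕ (rankM m w) × PrefersW M w m ×
    (∀ w' → toℕ (rankM m (μ M m)) < toℕ (rankM m w') → toℕ (rankM m w') < toℕ (rankM m w)
          → ¬ PrefersW M w' m)

  cycPairs : {A : Set} → List A → List (A × A)
  cycPairs []       = []
  cycPairs (x ∷ xs) = zip (x ∷ xs) (xs ++ [ x ])

  -- ρ = (m_0,w_0),...,(m_{r-1},w_{r-1}) is a rotation exposed in M:
  -- distinct men, M(m_i) = w_i, and w_{i+1 mod r} = s_M(m_i).
  ExposedIn : Matching → List (Fin n × Fin n) → Set
  ExposedIn M ρ =
    (0 < length ρ) × Unique (map proj₁ ρ) ×
    All (λ p → μ M (proj₁ p) ≡ proj₂ p) ρ ×
    All (λ q → IsNext M (proj₁ (proj₁ q)) (proj₂ (proj₂ q))) (cycPairs ρ)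

  IsRotation : List (Fin n × Fin n) → Set
  IsRotation ρ = Σ Matching λ M → Stable M × ExposedIn M ρ

-- rotations are cyclic sequences: identified up to cyclic shift
CyclicEq : {A : Set} → List A → List A → Set
CyclicEq ρ σ = ∃[ i ] (drop i ρ ++ take i ρ ≡ σ)

{-# OPTIONS --safe #-}
module Submission where

-- Put D = k - 1, so any two lists rank a given agent within D of each other.  If m is
-- matched to w in a stable matching, every woman m prefers to w is held by a man she prefers to m;
-- these men are distinct, and moving ranks through two lists shows that any woman v ranks them
-- within 2D above m, so m ranks w at most 2D below where v ranks m.  The symmetric bound for w,
-- chained with this one, puts all stable partners of an agent in a window of 4D + 1 ranks.  The
-- same estimate applies to the woman s(m) following w in a rotation (using D > 0 for the step at
-- w itself), and a rotation is determined by any one of its pairs (compare both exposing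
-- matchings with their join), so the rotations through an agent occupy a window of 4D ranks.
-- If D = 0 all men share one list and no rotation exists.

open import Defs
open import Data.Nat using (ℕ; zero; suc; _≤_; _<_; _+_; _*_; _∸_; _⊔_; _⊓_; z≤n; s≤s; _<?_)
open import Data.Nat.Properties
open import Data.Nat.Tactic.RingSolver using (solve-∀)
open import Data.Fin as Fin using (Fin; toℕ; fromℕ<; punchOut)
open import Data.Fin.Properties
  using (any?; injective⇒≤; punchOut-injective; toℕ-fromℕ<; toℕ-injective; toℕ-inject≤; toℕ<n)
open import Data.List using (List; []; _∷_; map; foldr; allFin; _++_; [_]; zip; length; lookup; drop; take)
open import Data.List.Properties using (++-assoc; ++-identityʳ; ∷-injective)
open import Data.List.Extrema.Nat using (argmin; argmin-all; f[argmin]≤f[⊤]; f[argmin]≤f[xs])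
open import Data.List.Relation.Unary.All as All using (All; []; _∷_)
open import Data.List.Relation.Unary.AllPairs as AllPairs using (AllPairs; []; _∷_)
open import Data.List.Relation.Unary.Any using (here; there)
open import Data.List.Relation.Unary.Unique.Propositional using (Unique)
import Data.List.Relation.Unary.Unique.Propositional.Properties as Unique
open import Data.List.Membership.Propositional using (_∈_; _∉_)
open import Data.List.Membership.Propositional.Properties
  using (∈-lookup; ∈-map⁺; ∈-allFin; ∈-++⁺ˡ; ∈-++⁺ʳ; ∈-++⁻; ∈-∃++)
open import Data.Product using (∃; _×_; _,_; proj₁; proj₂)
open import Data.Sum using (_⊎_; inj₁; inj₂)
open import Data.Empty using (⊥)
open import Function.Base using (_on_; _∘_)
open import Function.Definitions using (Injective)
open import Relation.Binary.PropositionalEquality hiding ([_])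
open import Relation.Nullary using (¬_; Dec; yes; no)
open import Relation.Nullary.Negation using (contradiction)
open import Relation.Unary using (Decidable)
open import Relation.Binary.Definitions using (tri<; tri≈; tri>)

injective⇒surjective : ∀ {n} (f : Fin n → Fin n) → Injective _≡_ _≡_ f → ∀ y → ∃ λ x → f x ≡ y
injective⇒surjective {suc n} f f-inj y with any? (λ x → f x Fin.≟ y)
... | yes hit = hit
... | no miss = contradiction (injective⇒≤ squeeze-inj) 1+n≰n
  where
  y≢f : ∀ x → y ≢ f x
  y≢f x y≡fx = miss (x , sym y≡fx)
  squeeze : Fin (suc n) → Fin n
  squeeze x = punchOut (y≢f x)
  squeeze-inj : Injective _≡_ _≡_ squeeze
  squeeze-inj eq = f-inj (punchOut-injective (y≢f _) (y≢f _) eq)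

-- Extend f by the identity off P: the result is injective on all of Fin n.
injectiveOn⇒surjectiveOn : ∀ {n} (P : Fin n → Set) → Decidable P → (f : Fin n → Fin n) →
  (∀ {x} → P x → P (f x)) → (∀ {x y} → P x → P y → f x ≡ f y → x ≡ y) →
  ∀ {y} → P y → ∃ λ x → P x × f x ≡ y
injectiveOn⇒surjectiveOn {n} P P? f f-pres f-inj {y} Py =
  preimage (P? _)
    (proj₂ (injective⇒surjective (λ x → extend x (P? x)) (λ {x} {x′} → extend-inj (P? x) (P? x′)) y))
  where
  extend : ∀ x → Dec (P x) → Fin n
  extend x (yes _) = f x
  extend x (no _)  = x
  extend-inj : ∀ {x x′} (Px? : Dec (P x)) (Px′? : Dec (P x′)) → extend x Px? ≡ extend x′ Px′? → x ≡ x′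
  extend-inj (yes Px) (yes Px′) eq  = f-inj Px Px′ eq
  extend-inj (yes Px) (no ¬Px′) eq  = contradiction (subst P eq (f-pres Px)) ¬Px′
  extend-inj (no ¬Px) (yes Px′) eq  = contradiction (subst P (sym eq) (f-pres Px′)) ¬Px
  extend-inj (no _)   (no _)    eq  = eq
  preimage : ∀ {x} (Px? : Dec (P x)) → extend x Px? ≡ y → ∃ λ x → P x × f x ≡ y
  preimage (yes Px) eq = _ , Px , eq
  preimage (no ¬Px) eq = contradiction (subst P (sym eq) Py) ¬Px

lookup-injectiveOn : ∀ {A B : Set} (g : A → B) {xs : List A} → AllPairs (_≢_ on g) xs →
  ∀ {i j} → g (lookup xs i) ≡ g (lookup xs j) → i ≡ j
lookup-injectiveOn g {_ ∷ _} (_ ∷ _) {Fin.zero} {Fin.zero} _ = refl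
lookup-injectiveOn g {_ ∷ _} (x≢ ∷ _) {Fin.zero} {Fin.suc j} eq = contradiction eq (All.lookup x≢ (∈-lookup j))
lookup-injectiveOn g {_ ∷ _} (x≢ ∷ _) {Fin.suc i} {Fin.zero} eq = contradiction (sym eq) (All.lookup x≢ (∈-lookup i))
lookup-injectiveOn g {_ ∷ _} (_ ∷ xs≢) {Fin.suc i} {Fin.suc j} eq = cong Fin.suc (lookup-injectiveOn g xs≢ eq)

-- Offsets from the minimal value embed the list into Fin B.
window⇒length≤ : ∀ {A : Set} (g : A → ℕ) B (xs : List A) → AllPairs (_≢_ on g) xs →
  (∀ {a b} → a ∈ xs → b ∈ xs → g a < g b + B) → length xs ≤ B
window⇒length≤ g B [] _ _ = z≤n
window⇒length≤ {A} g B (x ∷ xs) distinct window = injective⇒≤ {f = slot} slot-inj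
  where
  least : A
  least = argmin g x xs
  least∈ : least ∈ x ∷ xs
  least∈ = argmin-all g (here refl) (All.tabulate there)
  least≤ : All (λ a → g least ≤ g a) (x ∷ xs)
  least≤ = f[argmin]≤f[⊤] {f = g} x xs ∷ f[argmin]≤f[xs] {f = g} x xs
  offset : Fin (length (x ∷ xs)) → ℕ
  offset i = g (lookup (x ∷ xs) i) ∸ g least
  offset<B : ∀ i → offset i < B
  offset<B i = subst (offset i <_) (m+n∸m≡n (g least) B)
    (∸-monoˡ-< (window (∈-lookup i) least∈) (All.lookup least≤ (∈-lookup i)))
  slot : Fin (length (x ∷ xs)) → Fin B
  slot i = fromℕ< (offset<B i)
  slot-inj : Injective _≡_ _≡_ slot
  slot-inj {i} {j} eq = lookup-injectiveOn g distinct
    (∸-cancelʳ-≡ (All.lookup least≤ (∈-lookup i)) (All.lookup least≤ (∈-lookup j))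
      (trans (sym (toℕ-fromℕ< _)) (trans (cong toℕ eq) (toℕ-fromℕ< _))))

prefix-injection⇒≤ : ∀ {n} (key : Fin n → Fin n) → Injective _≡_ _≡_ key →
  (G : Fin n → ℕ) {a b : ℕ} → a ≤ n →
  (∀ x → toℕ (key x) < a → G x < b) →
  (∀ {x y} → toℕ (key x) < a → toℕ (key y) < a → G x ≡ G y → x ≡ y) → a ≤ b
prefix-injection⇒≤ {n} key key-inj G {a} {b} a≤n G<b G-inj = injective⇒≤ {f = embed} embed-inj
  where
  ranked : Fin a → Fin n
  ranked i = proj₁ (injective⇒surjective key key-inj (Fin.inject≤ i a≤n))
  key-ranked : ∀ i → toℕ (key (ranked i)) ≡ toℕ i
  key-ranked i =
    trans (cong toℕ (proj₂ (injective⇒surjective key key-inj (Fin.inject≤ i a≤n)))) (toℕ-inject≤ i a≤n)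
  ranked<a : ∀ i → toℕ (key (ranked i)) < a
  ranked<a i = subst (_< a) (sym (key-ranked i)) (toℕ<n i)
  embed : Fin a → Fin b
  embed i = fromℕ< (G<b (ranked i) (ranked<a i))
  embed-inj : Injective _≡_ _≡_ embed
  embed-inj {i} {j} eq = toℕ-injective (trans (sym (key-ranked i))
    (trans (cong (toℕ ∘ key) (G-inj (ranked<a i) (ranked<a j)
      (trans (sym (toℕ-fromℕ< _)) (trans (cong toℕ eq) (toℕ-fromℕ< _))))) (key-ranked j)))

≤-+-trans : ∀ {x} y z e f → x ≤ y + e → y ≤ z + f → x ≤ z + (f + e)
≤-+-trans y z e f x≤y+e y≤z+f = ≤-trans x≤y+e (≤-trans (+-monoˡ-≤ e y≤z+f) (≤-reflexive (+-assoc z f e)))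

AllPairs-mapWith : ∀ {A : Set} {R S : A → A → Set} {P : A → Set} {xs : List A} →
  (∀ {a b} → P a → P b → R a b → S a b) → All P xs → AllPairs R xs → AllPairs S xs
AllPairs-mapWith f [] [] = []
AllPairs-mapWith f (pa ∷ ps) (ra ∷ rs) = All.zipWith (λ (pb , rb) → f pa pb rb) (ps , ra) ∷ AllPairs-mapWith f ps rs

module _ {A : Set} where

  cyclicPairs : List A → List (A × A)
  cyclicPairs []       = []
  cyclicPairs (x ∷ xs) = zip (x ∷ xs) (xs ++ [ x ])

  data Consecutive : List A → A → A → Set where
    now   : ∀ {u v l} → Consecutive (u ∷ v ∷ l) u v
    later : ∀ {x u v l} → Consecutive l u v → Consecutive (x ∷ l) u v

  zip-snoc⇒Consecutive : ∀ a as z {u v} → (u , v) ∈ zip (a ∷ as) (as ++ [ z ]) →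
    Consecutive (a ∷ as ++ [ z ]) u v
  zip-snoc⇒Consecutive a []       z (here refl) = now
  zip-snoc⇒Consecutive a (b ∷ bs) z (here refl) = now
  zip-snoc⇒Consecutive a (b ∷ bs) z (there uv∈) = later (zip-snoc⇒Consecutive b bs z uv∈)

  Consecutive⇒zip-snoc : ∀ a as z {u v} → Consecutive (a ∷ as ++ [ z ]) u v →
    (u , v) ∈ zip (a ∷ as) (as ++ [ z ])
  Consecutive⇒zip-snoc a []       z now               = here refl
  Consecutive⇒zip-snoc a []       z (later (later ()))
  Consecutive⇒zip-snoc a (b ∷ bs) z now               = here refl
  Consecutive⇒zip-snoc a (b ∷ bs) z (later c)         = there (Consecutive⇒zip-snoc b bs z c)

  Consecutive-∈ˡ : ∀ {l u v} → Consecutive l u v → u ∈ l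
  Consecutive-∈ˡ now       = here refl
  Consecutive-∈ˡ (later c) = there (Consecutive-∈ˡ c)

  Consecutive-∈ʳ : ∀ {l u v} → Consecutive l u v → v ∈ l
  Consecutive-∈ʳ now       = there (here refl)
  Consecutive-∈ʳ (later c) = there (Consecutive-∈ʳ c)

  Consecutive-++⁺ˡ : ∀ {xs} ys {u v} → Consecutive xs u v → Consecutive (xs ++ ys) u v
  Consecutive-++⁺ˡ ys now       = now
  Consecutive-++⁺ˡ ys (later c) = later (Consecutive-++⁺ˡ ys c)

  Consecutive-++⁺ʳ : ∀ xs {ys u v} → Consecutive ys u v → Consecutive (xs ++ ys) u v
  Consecutive-++⁺ʳ []       c = c
  Consecutive-++⁺ʳ (x ∷ xs) c = later (Consecutive-++⁺ʳ xs c)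

  Consecutive-++⁻ : ∀ xs y ys {u v} → Consecutive (xs ++ y ∷ ys) u v →
    Consecutive (xs ++ [ y ]) u v ⊎ Consecutive (y ∷ ys) u v
  Consecutive-++⁻ []           y ys c         = inj₂ c
  Consecutive-++⁻ (x ∷ [])     y ys now       = inj₁ now
  Consecutive-++⁻ (x ∷ [])     y ys (later c) = inj₂ c
  Consecutive-++⁻ (x ∷ x′ ∷ xs) y ys now      = inj₁ now
  Consecutive-++⁻ (x ∷ x′ ∷ xs) y ys (later c) with Consecutive-++⁻ (x′ ∷ xs) y ys c
  ... | inj₁ c′ = inj₁ (later c′)
  ... | inj₂ c′ = inj₂ c′

  successor : ∀ l z {p} → p ∈ l → ∃ λ q → Consecutive (l ++ [ z ]) p q
  successor (y ∷ [])     z (here refl) = z , now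
  successor (y ∷ y′ ∷ l) z (here refl) = y′ , now
  successor (y ∷ l)      z (there p∈)  with q , c ← successor l z p∈ = q , later c

  predecessor : ∀ a l {p} → p ∈ l → ∃ λ d → Consecutive (a ∷ l) d p
  predecessor a (y ∷ l) (here refl) = a , now
  predecessor a (y ∷ l) (there p∈) with d , c ← predecessor y l p∈ = d , later c

  ∈-closed⁻ : ∀ {x : A} {xs a} → a ∈ x ∷ xs ++ [ x ] → a ∈ x ∷ xs
  ∈-closed⁻ (here eq) = here eq
  ∈-closed⁻ {xs = xs} (there a∈) with ∈-++⁻ xs a∈
  ... | inj₁ a∈xs      = there a∈xs
  ... | inj₂ (here eq) = here eq

  ∈-closed⁺ : ∀ {x : A} {xs a} → a ∈ x ∷ xs → a ∈ xs ++ [ x ]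
  ∈-closed⁺ {xs = xs} (here eq) = ∈-++⁺ʳ xs (here eq)
  ∈-closed⁺           (there a∈) = ∈-++⁺ˡ a∈

  cyclicPairs-∈ˡ : ∀ ρ {p q} → (p , q) ∈ cyclicPairs ρ → p ∈ ρ
  cyclicPairs-∈ˡ (x ∷ xs) pq = ∈-closed⁻ (Consecutive-∈ˡ (zip-snoc⇒Consecutive x xs x pq))

  cyclicPairs-∈ʳ : ∀ ρ {p q} → (p , q) ∈ cyclicPairs ρ → q ∈ ρ
  cyclicPairs-∈ʳ (x ∷ xs) pq = ∈-closed⁻ (Consecutive-∈ʳ (zip-snoc⇒Consecutive x xs x pq))

  cyclic-successor : ∀ ρ {p} → p ∈ ρ → ∃ λ q → (p , q) ∈ cyclicPairs ρ
  cyclic-successor (x ∷ xs) p∈ with q , c ← successor (x ∷ xs) x p∈ = q , Consecutive⇒zip-snoc x xs x c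

  cyclic-predecessor : ∀ ρ {p} → p ∈ ρ → ∃ λ d → (d , p) ∈ cyclicPairs ρ
  cyclic-predecessor (x ∷ xs) p∈ with d , c ← predecessor x (xs ++ [ x ]) (∈-closed⁺ p∈) =
    d , Consecutive⇒zip-snoc x xs x c

  module _ (P : A → Set) where

    propagate-to-end : ∀ l z → (∀ {u v} → Consecutive (l ++ [ z ]) u v → P u → P v) →
      ∀ {a} → a ∈ l → P a → P z
    propagate-to-end (y ∷ [])     z step (here refl) Pa = step now Pa
    propagate-to-end (y ∷ y′ ∷ l) z step (here refl) Pa =
      propagate-to-end (y′ ∷ l) z (step ∘ later) (here refl) (step now Pa)
    propagate-to-end (y ∷ l)      z step (there a∈)  Pa = propagate-to-end l z (step ∘ later) a∈ Pa

    propagate-from-head : ∀ x l → (∀ {u v} → Consecutive (x ∷ l) u v → P u → P v) →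
      P x → ∀ {b} → b ∈ x ∷ l → P b
    propagate-from-head x l       step Px (here refl) = Px
    propagate-from-head x (y ∷ l) step Px (there b∈)  = propagate-from-head y l (step ∘ later) (step now Px) b∈

    cyclic-propagate : ∀ ρ → (∀ {u v} → (u , v) ∈ cyclicPairs ρ → P u → P v) →
      ∀ {a b} → a ∈ ρ → b ∈ ρ → P a → P b
    cyclic-propagate (x ∷ xs) step a∈ b∈ Pa =
      propagate-from-head x (xs ++ [ x ]) step′ (propagate-to-end (x ∷ xs) x step′ a∈ Pa) (widen b∈)
      where
      step′ : ∀ {u v} → Consecutive (x ∷ xs ++ [ x ]) u v → P u → P v
      step′ c = step (Consecutive⇒zip-snoc x xs x c)
      widen : ∀ {b} → b ∈ x ∷ xs → b ∈ x ∷ xs ++ [ x ]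
      widen (here eq)  = here eq
      widen (there b∈) = there (∈-++⁺ˡ b∈)

  cyclic-¬strictlyIncreasing : ∀ (f : A → ℕ) x xs →
    ¬ (∀ {u v} → (u , v) ∈ cyclicPairs (x ∷ xs) → f u < f v)
  cyclic-¬strictlyIncreasing f x xs increasing with q , xq ← cyclic-successor (x ∷ xs) (here refl) =
    <-irrefl refl (cyclic-propagate (λ p → f x < f p) (x ∷ xs)
      (λ uv fx<fu → <-trans fx<fu (increasing uv)) (cyclicPairs-∈ʳ (x ∷ xs) xq) (here refl) (increasing xq))

  Unique-middle⇒∉ : ∀ (xs : List A) {p ys} → Unique (xs ++ p ∷ ys) → p ∉ ys ++ xs
  Unique-middle⇒∉ xs {p} {ys} xs++p∷ys! p∈ with ∈-++⁻ ys p∈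
  ... | inj₁ p∈ys = ∉-after xs xs++p∷ys! p∈ys
    where
    ∉-after : ∀ (xs : List A) → Unique (xs ++ p ∷ ys) → p ∉ ys
    ∉-after []       (p≢ ∷ _) p∈ys = All.lookup p≢ p∈ys refl
    ∉-after (_ ∷ xs) (_ ∷ !)       = ∉-after xs !
  ... | inj₂ p∈xs = ∉-before xs xs++p∷ys! p∈xs
    where
    ∉-before : ∀ (xs : List A) → Unique (xs ++ p ∷ ys) → p ∉ xs
    ∉-before (x ∷ xs) (x≢ ∷ _) (here refl) = All.lookup x≢ (∈-++⁺ʳ xs (here refl)) refl
    ∉-before (x ∷ xs) (_ ∷ !)  (there p∈xs) = ∉-before xs ! p∈xs

  Consecutive-rotate : ∀ p xs ys {u v} → Consecutive (p ∷ (ys ++ xs) ++ [ p ]) u v →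
    (u , v) ∈ cyclicPairs (xs ++ p ∷ ys)
  Consecutive-rotate p [] ys {u} {v} c =
    Consecutive⇒zip-snoc p ys p (subst (λ l → Consecutive (p ∷ l ++ [ p ]) u v) (++-identityʳ ys) c)
  Consecutive-rotate p (a ∷ xs) ys {u} {v} c = Consecutive⇒zip-snoc a (xs ++ p ∷ ys) a (reassemble split)
    where
    split : Consecutive (p ∷ ys ++ [ a ]) u v ⊎ Consecutive (a ∷ xs ++ [ p ]) u v
    split = Consecutive-++⁻ (p ∷ ys) a (xs ++ [ p ])
      (subst (λ l → Consecutive (p ∷ l) u v) (++-assoc ys (a ∷ xs) [ p ]) c)
    reassemble : _ → Consecutive (a ∷ (xs ++ p ∷ ys) ++ [ a ]) u v
    reassemble (inj₁ c′) = subst (λ l → Consecutive (a ∷ l) u v) (sym (++-assoc xs (p ∷ ys) [ a ]))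
      (Consecutive-++⁺ʳ (a ∷ xs) c′)
    reassemble (inj₂ c′) = subst (λ l → Consecutive (a ∷ l) u v)
      (trans (++-assoc xs [ p ] (ys ++ [ a ])) (sym (++-assoc xs (p ∷ ys) [ a ])))
      (Consecutive-++⁺ˡ (ys ++ [ a ]) c′)

  Consecutive-functional⇒≡ : ∀ z a xs ys → z ∉ xs → z ∉ ys →
    (∀ {u v v′} → Consecutive (a ∷ xs ++ [ z ]) u v → Consecutive (a ∷ ys ++ [ z ]) u v′ → v ≡ v′) →
    xs ≡ ys
  Consecutive-functional⇒≡ z a []       []       _    _    _ = refl
  Consecutive-functional⇒≡ z a []       (y ∷ ys) _    z∉ys fun = contradiction (here (fun now now)) z∉ys
  Consecutive-functional⇒≡ z a (x ∷ xs) []       z∉xs _    fun = contradiction (here (sym (fun now now))) z∉xs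
  Consecutive-functional⇒≡ z a (x ∷ xs) (y ∷ ys) z∉xs z∉ys fun with refl ← fun now now =
    cong (x ∷_) (Consecutive-functional⇒≡ z x xs ys (z∉xs ∘ there) (z∉ys ∘ there)
      (λ c c′ → fun (later c) (later c′)))

  ++-≡⇒overlap : ∀ (ws xs ys zs : List A) → ws ++ xs ≡ ys ++ zs →
    (∃ λ t → ys ≡ ws ++ t × xs ≡ t ++ zs) ⊎ (∃ λ t → ws ≡ ys ++ t × zs ≡ t ++ xs)
  ++-≡⇒overlap []       xs ys       zs eq = inj₁ (ys , refl , eq)
  ++-≡⇒overlap (w ∷ ws) xs []       zs eq = inj₂ (w ∷ ws , refl , sym eq)
  ++-≡⇒overlap (w ∷ ws) xs (y ∷ ys) zs eq
    with refl , eq′ ← ∷-injective eq with ++-≡⇒overlap ws xs ys zs eq′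
  ... | inj₁ (t , ys≡ , xs≡) = inj₁ (t , cong (w ∷_) ys≡ , xs≡)
  ... | inj₂ (t , ws≡ , zs≡) = inj₂ (t , cong (w ∷_) ws≡ , zs≡)

  CyclicEq-swap : ∀ (xs ys : List A) → CyclicEq (xs ++ ys) (ys ++ xs)
  CyclicEq-swap xs ys = length xs , cong₂ _++_ (drop-length xs) (take-length xs)
    where
    drop-length : ∀ (xs : List A) → drop (length xs) (xs ++ ys) ≡ ys
    drop-length []       = refl
    drop-length (_ ∷ xs) = drop-length xs
    take-length : ∀ (xs : List A) → take (length xs) (xs ++ ys) ≡ xs
    take-length []       = refl
    take-length (x ∷ xs) = cong (x ∷_) (take-length xs)

  CyclicEq-around : ∀ (p : A) xs ys zs ws → ys ++ xs ≡ ws ++ zs → CyclicEq (xs ++ p ∷ ys) (zs ++ p ∷ ws)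
  CyclicEq-around p xs ys zs ws eq with ++-≡⇒overlap ys xs ws zs eq
  ... | inj₁ (t , refl , refl) =
    subst₂ CyclicEq (sym (++-assoc t zs (p ∷ ys))) (++-assoc zs (p ∷ ys) t) (CyclicEq-swap t (zs ++ p ∷ ys))
  ... | inj₂ (t , refl , refl) =
    subst₂ CyclicEq (++-assoc xs (p ∷ ws) t) (sym (++-assoc t xs (p ∷ ws))) (CyclicEq-swap (xs ++ p ∷ ws) t)

  sameSuccessors⇒CyclicEq : ∀ {ρ σ p} → Unique ρ → Unique σ → p ∈ ρ → p ∈ σ →
    (∀ {u v v′} → (u , v) ∈ cyclicPairs ρ → (u , v′) ∈ cyclicPairs σ → v ≡ v′) → CyclicEq ρ σ
  sameSuccessors⇒CyclicEq {p = p} ρ! σ! p∈ρ p∈σ fun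
    with xs , ys , refl ← ∈-∃++ p∈ρ | zs , ws , refl ← ∈-∃++ p∈σ =
    CyclicEq-around p xs ys zs ws
      (Consecutive-functional⇒≡ p p (ys ++ xs) (ws ++ zs) (Unique-middle⇒∉ xs ρ!) (Unique-middle⇒∉ zs σ!)
        (λ c c′ → fun (Consecutive-rotate p xs ys c) (Consecutive-rotate p zs ws c′)))

module _ {n : ℕ} (I : Instance n) where
  open Instance I

  rkM : Fin n → Fin n → ℕ
  rkM m w = toℕ (rankM m w)

  rkW : Fin n → Fin n → ℕ
  rkW w m = toℕ (rankW w m)

  rkM-injective : ∀ m {w w′} → rkM m w ≡ rkM m w′ → w ≡ w′
  rkM-injective m eq = rankM-inj m (toℕ-injective eq)

  rkW-injective : ∀ w {m m′} → rkW w m ≡ rkW w m′ → m ≡ m′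
  rkW-injective w eq = rankW-inj w (toℕ-injective eq)

  husband : Matching I → Fin n → Fin n
  husband M w = proj₁ (injective⇒surjective (μ M) (μ-inj M) w)

  μ-husband : ∀ M w → μ M (husband M w) ≡ w
  μ-husband M w = proj₂ (injective⇒surjective (μ M) (μ-inj M) w)

  husband-unique : ∀ M {m w} → μ M m ≡ w → husband M w ≡ m
  husband-unique M {m} refl = μ-inj M (μ-husband M (μ M m))

  PrefersW⇒< : ∀ M {w m} → PrefersW I M w m → rkW w m < rkW w (husband M w)
  PrefersW⇒< M {w} prefers = prefers (husband M w) (μ-husband M w)

  <⇒PrefersW : ∀ M {w m} → rkW w m < rkW w (husband M w) → PrefersW I M w m
  <⇒PrefersW M {w} {m} lt m′ μm′≡w = subst (λ h → rkW w m < rkW w h) (husband-unique M μm′≡w) lt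

  stable⇒husband-preferred : ∀ {M} → Stable I M → ∀ {m w} →
    rkM m w < rkM m (μ M m) → rkW w (husband M w) < rkW w m
  stable⇒husband-preferred {M} stable {m} {w} m-prefers-w = ≤∧≢⇒< (≮⇒≥ w-indifferent) husband≢m
    where
    w-indifferent : ¬ rkW w m < rkW w (husband M w)
    w-indifferent w-prefers-m = stable m w (m-prefers-w , <⇒PrefersW M w-prefers-m)
    husband≢m : rkW w (husband M w) ≢ rkW w m
    husband≢m eq = <-irrefl (cong (rkM m) (trans (sym (μ-husband M w)) (cong (μ M) (rkW-injective w eq))))
      m-prefers-w

  stable⇒wife-preferred : ∀ {M} → Stable I M → ∀ {m w} →
    rkW w m < rkW w (husband M w) → rkM m (μ M m) < rkM m w
  stable⇒wife-preferred {M} stable {m} {w} w-prefers-m = ≤∧≢⇒< (≮⇒≥ m-indifferent) wife≢w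
    where
    m-indifferent : ¬ rkM m w < rkM m (μ M m)
    m-indifferent m-prefers-w = stable m w (m-prefers-w , <⇒PrefersW M w-prefers-m)
    wife≢w : rkM m (μ M m) ≢ rkM m w
    wife≢w eq = <-irrefl (cong (rkW w) (sym (husband-unique M (rkM-injective m eq)))) w-prefers-m

  -- switch a, the M′-husband of a's M-wife, maps the men preferring M injectively into themselves,
  -- hence onto them: m = switch z, and μ M z = μ M′ m prefers m to z by stability of M′.
  opposing-interests : ∀ {M M′} → Stable I M → Stable I M′ → ∀ {m} →
    rkM m (μ M m) < rkM m (μ M′ m) → rkW (μ M′ m) m < rkW (μ M′ m) (husband M (μ M′ m))
  opposing-interests {M} {M′} M-stable M′-stable m-prefers-M =
    from-preimage (injectiveOn⇒surjectiveOn PrefersM (λ a → rkM a (μ M a) <? rkM a (μ M′ a))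
      switch switch-preserves switch-injective m-prefers-M)
    where
    PrefersM : Fin n → Set
    PrefersM a = rkM a (μ M a) < rkM a (μ M′ a)
    switch : Fin n → Fin n
    switch a = husband M′ (μ M a)
    wife-prefers-switch : ∀ {a} → PrefersM a → rkW (μ M a) (switch a) < rkW (μ M a) a
    wife-prefers-switch = stable⇒husband-preferred M′-stable
    switch-preserves : ∀ {a} → PrefersM a → PrefersM (switch a)
    switch-preserves {a} a-prefers-M = subst (λ w → rkM (switch a) (μ M (switch a)) < rkM (switch a) w)
      (sym (μ-husband M′ (μ M a)))
      (stable⇒wife-preferred M-stable
        (subst (λ h → rkW (μ M a) (switch a) < rkW (μ M a) h) (sym (husband-unique M refl))
          (wife-prefers-switch a-prefers-M)))
    switch-injective : ∀ {a b} → PrefersM a → PrefersM b → switch a ≡ switch b → a ≡ b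
    switch-injective {a} {b} _ _ eq =
      μ-inj M (trans (sym (μ-husband M′ (μ M a))) (trans (cong (μ M′) eq) (μ-husband M′ (μ M b))))
    from-preimage : ∀ {m} → (∃ λ z → PrefersM z × switch z ≡ m) →
      rkW (μ M′ m) m < rkW (μ M′ m) (husband M (μ M′ m))
    from-preimage (z , z-prefers-M , refl) rewrite μ-husband M′ (μ M z) | husband-unique M {z} refl =
      wife-prefers-switch z-prefers-M

  -- Every man takes the worse of his partners in M and M′ (the join in the lattice of stable matchings).
  module Join {M M′ : Matching I} (M-stable : Stable I M) (M′-stable : Stable I M′) where

    private
      PrefersM : Fin n → Set
      PrefersM m = rkM m (μ M m) < rkM m (μ M′ m)

      PrefersM? : ∀ m → Dec (PrefersM m)
      PrefersM? m = rkM m (μ M m) <? rkM m (μ M′ m)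

      pick : ∀ m → Dec (PrefersM m) → Fin n
      pick m (yes _) = μ M′ m
      pick m (no _)  = μ M m

      crossing-injective : ∀ {m m′} → PrefersM m → ¬ PrefersM m′ → μ M′ m ≡ μ M m′ → m ≡ m′
      crossing-injective {m} {m′} m-prefers-M ¬m′-prefers-M eq with m≤n⇒m<n∨m≡n (≮⇒≥ ¬m′-prefers-M)
      ... | inj₂ same = μ-inj M′ (trans eq (sym (rkM-injective m′ same)))
      ... | inj₁ m′-prefers-M′ = contradiction m′-preferred (<-asym m-preferred)
        where
        m-preferred : rkW (μ M m′) m < rkW (μ M m′) m′
        m-preferred = subst (λ h → rkW (μ M m′) m < rkW (μ M m′) h) (husband-unique M {m′} refl)
          (subst (λ w → rkW w m < rkW w (husband M w)) eq
            (opposing-interests {M} {M′} M-stable M′-stable m-prefers-M))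
        m′-preferred : rkW (μ M m′) m′ < rkW (μ M m′) m
        m′-preferred = subst (λ h → rkW (μ M m′) m′ < rkW (μ M m′) h) (husband-unique M′ eq)
                         (opposing-interests {M′} {M} M′-stable M-stable m′-prefers-M′)

      pick-injective : ∀ {m m′} (d : Dec (PrefersM m)) (d′ : Dec (PrefersM m′)) →
        pick m d ≡ pick m′ d′ → m ≡ m′
      pick-injective (yes _)  (yes _)  eq = μ-inj M′ eq
      pick-injective (yes p)  (no ¬p′) eq = crossing-injective p ¬p′ eq
      pick-injective (no ¬p)  (yes p′) eq = sym (crossing-injective p′ ¬p (sym eq))
      pick-injective (no _)   (no _)   eq = μ-inj M eq

      pick-worseˡ : ∀ m d → rkM m (μ M m) ≤ rkM m (pick m d)
      pick-worseˡ m (yes prefers) = <⇒≤ prefers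
      pick-worseˡ m (no _)        = ≤-refl

      pick-worseʳ : ∀ m d → rkM m (μ M′ m) ≤ rkM m (pick m d)
      pick-worseʳ m (yes _)        = ≤-refl
      pick-worseʳ m (no ¬prefers) = ≮⇒≥ ¬prefers

      pick-cases : ∀ m d → pick m d ≡ μ M m ⊎ pick m d ≡ μ M′ m
      pick-cases m (yes _) = inj₂ refl
      pick-cases m (no _)  = inj₁ refl

      pick-favoured : ∀ m d → let w = pick m d in
        rkW w m ≤ rkW w (husband M w) × rkW w m ≤ rkW w (husband M′ w)
      pick-favoured m (yes prefers) =
        <⇒≤ (opposing-interests {M} {M′} M-stable M′-stable prefers) ,
        ≤-reflexive (cong (rkW (μ M′ m)) (sym (husband-unique M′ refl)))
      pick-favoured m (no ¬prefers) with m≤n⇒m<n∨m≡n (≮⇒≥ ¬prefers)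
      ... | inj₁ prefers′ =
        ≤-reflexive (cong (rkW (μ M m)) (sym (husband-unique M refl))) ,
        <⇒≤ (opposing-interests {M′} {M} M′-stable M-stable prefers′)
      ... | inj₂ same =
        ≤-reflexive (cong (rkW (μ M m)) (sym (husband-unique M refl))) ,
        ≤-reflexive (cong (rkW (μ M m)) (sym (husband-unique M′ (rkM-injective m same))))

    -- Opaque, so that the case split inside μ join is never unfolded in later goals.
    opaque
      join : Matching I
      join = record
        { μ     = λ m → pick m (PrefersM? m)
        ; μ-inj = λ {m} {m′} → pick-injective (PrefersM? m) (PrefersM? m′)
        }

      join-worseˡ : ∀ m → rkM m (μ M m) ≤ rkM m (μ join m)
      join-worseˡ m = pick-worseˡ m (PrefersM? m)

      join-worseʳ : ∀ m → rkM m (μ M′ m) ≤ rkM m (μ join m)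
      join-worseʳ m = pick-worseʳ m (PrefersM? m)

      join-cases : ∀ m → μ join m ≡ μ M m ⊎ μ join m ≡ μ M′ m
      join-cases m = pick-cases m (PrefersM? m)

      join-stable : Stable I join
      join-stable m w (m-prefers-w , w-prefers-m) = unblocked (join-cases m)
        where
        z : Fin n
        z = husband join w
        w-prefers-m-to-z : rkW w m < rkW w z
        w-prefers-m-to-z = PrefersW⇒< join w-prefers-m
        z-favoured : rkW w z ≤ rkW w (husband M w) × rkW w z ≤ rkW w (husband M′ w)
        z-favoured = subst (λ v → rkW v z ≤ rkW v (husband M v) × rkW v z ≤ rkW v (husband M′ v))
                       (μ-husband join w) (pick-favoured z (PrefersM? z))
        unblocked : μ join m ≡ μ M m ⊎ μ join m ≡ μ M′ m → ⊥
        unblocked (inj₁ eq) = M-stable m w (subst (λ v → rkM m w < rkM m v) eq m-prefers-w ,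
                                            <⇒PrefersW M (<-≤-trans w-prefers-m-to-z (proj₁ z-favoured)))
        unblocked (inj₂ eq) = M′-stable m w (subst (λ v → rkM m w < rkM m v) eq m-prefers-w ,
                                             <⇒PrefersW M′ (<-≤-trans w-prefers-m-to-z (proj₂ z-favoured)))

  cycPairs≡cyclicPairs : ∀ (ρ : List (Fin n × Fin n)) → cycPairs I ρ ≡ cyclicPairs ρ
  cycPairs≡cyclicPairs []      = refl
  cycPairs≡cyclicPairs (_ ∷ _) = refl

  exposed-matched : ∀ {M ρ} → ExposedIn I M ρ → ∀ {p} → p ∈ ρ → μ M (proj₁ p) ≡ proj₂ p
  exposed-matched (_ , _ , matched , _) = All.lookup matched

  exposed-next : ∀ {M ρ} → ExposedIn I M ρ → ∀ {p q} → (p , q) ∈ cyclicPairs ρ →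
    IsNext I M (proj₁ p) (proj₂ q)
  exposed-next {ρ = ρ} (_ , _ , _ , next) = All.lookup (subst (All _) (cycPairs≡cyclicPairs ρ) next)

  exposed-husband : ∀ {M ρ} → ExposedIn I M ρ → ∀ {p} → p ∈ ρ → husband M (proj₂ p) ≡ proj₁ p
  exposed-husband {M} exposed p∈ = husband-unique M (exposed-matched {M} exposed p∈)

  IsNext-skipped : ∀ {M m s x} → IsNext I M m s → rkM m (μ M m) < rkM m x → rkM m x < rkM m s →
    rkW x (husband M x) < rkW x m
  IsNext-skipped {M} {m} {s} {x} (_ , _ , first) after before = ≤∧≢⇒< (≮⇒≥ x-indifferent) husband≢m
    where
    x-indifferent : ¬ rkW x m < rkW x (husband M x)
    x-indifferent x-prefers-m = first x after before (<⇒PrefersW M x-prefers-m)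
    husband≢m : rkW x (husband M x) ≢ rkW x m
    husband≢m eq = <-irrefl (cong (rkM m) (trans (cong (μ M) (sym (rkW-injective x eq))) (μ-husband M x))) after

  module _ {M M′ : Matching I} (M-stable : Stable I M) (M′-stable : Stable I M′) where
    open Join {M} {M′} M-stable M′-stable

    Loses : Fin n → Set
    Loses m = rkM m (μ M m) < rkM m (μ join m)

    -- By opposing interests m's join-wife prefers m to her M-husband, so she is not above w₁ = s(m);
    -- if m₁ kept w₁, then (m , w₁) would block the join or m would be m₁.
    loses-along-rotation : ∀ {ρ} → ExposedIn I M ρ → ∀ {p q} → (p , q) ∈ cyclicPairs ρ →
      Loses (proj₁ p) → Loses (proj₁ q)
    loses-along-rotation {ρ} exposed {m , _} {m₁ , w₁} pq m-loses =
      ≤∧≢⇒< (join-worseˡ m₁) (λ eq → join-keeps-w₁ (trans (sym (rkM-injective m₁ eq)) w₁-wife))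
      where
      next : IsNext I M m w₁
      next = exposed-next {M} exposed pq
      w₁-wife : μ M m₁ ≡ w₁
      w₁-wife = exposed-matched {M} exposed (cyclicPairs-∈ʳ ρ pq)
      w₁-not-after-join-wife : rkM m w₁ ≤ rkM m (μ join m)
      w₁-not-after-join-wife = ≮⇒≥ λ before → proj₂ (proj₂ next) (μ join m) m-loses before
        (<⇒PrefersW M (opposing-interests {M} {join} M-stable join-stable m-loses))
      join-keeps-w₁ : μ join m₁ ≢ w₁
      join-keeps-w₁ eq with m≤n⇒m<n∨m≡n w₁-not-after-join-wife
      ... | inj₁ m-prefers-w₁ = join-stable m w₁ (m-prefers-w₁ , λ m′ μm′≡w₁ →
            subst (λ h → rkW w₁ m < rkW w₁ h) (μ-inj join (trans eq (sym μm′≡w₁)))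
              (subst (λ h → rkW w₁ m < rkW w₁ h) (husband-unique M w₁-wife)
                (PrefersW⇒< M (proj₁ (proj₂ next)))))
      ... | inj₂ same = <-irrefl (cong (rkM m) (trans (cong (μ M) m≡m₁) w₁-wife)) (proj₁ next)
        where
        m≡m₁ : m ≡ m₁
        m≡m₁ = μ-inj join (trans (sym (rkM-injective m same)) (sym eq))

    -- A man of ρ who keeps his partner in M′ does not lose, so by propagation around ρ nobody does.
    join-fixes-rotation : ∀ {ρ} → ExposedIn I M ρ → ∀ {p₀} → p₀ ∈ ρ → μ M′ (proj₁ p₀) ≡ proj₂ p₀ →
      ∀ {q} → q ∈ ρ → μ join (proj₁ q) ≡ proj₂ q
    join-fixes-rotation {ρ} exposed {m₀ , w₀} p₀∈ w₀-M′-wife {m , w} q∈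
      with m≤n⇒m<n∨m≡n (join-worseˡ m)
    ... | inj₂ same = trans (sym (rkM-injective m same)) (exposed-matched {M} exposed q∈)
    ... | inj₁ m-loses = contradiction
          (cyclic-propagate (Loses ∘ proj₁) ρ (loses-along-rotation exposed) q∈ p₀∈ m-loses) m₀-keeps
      where
      m₀-keeps : ¬ Loses m₀
      m₀-keeps loses with join-cases m₀
      ... | inj₁ eq = <-irrefl (cong (rkM m₀) (sym eq)) loses
      ... | inj₂ eq = <-irrefl
        (cong (rkM m₀) (trans (exposed-matched {M} exposed p₀∈) (sym (trans eq w₀-M′-wife)))) loses

    rival-prefers-M′ : ∀ {ρ} → ExposedIn I M ρ → ∀ {p₀} → p₀ ∈ ρ → μ M′ (proj₁ p₀) ≡ proj₂ p₀ →
      ∀ {m w} → (m , w) ∈ ρ → ∀ {c} → rkW w c < rkW w m → rkM c (μ M′ c) < rkM c w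
    rival-prefers-M′ exposed p₀∈ w₀-M′-wife {m} {w} q∈ {c} w-prefers-c = ≤-<-trans (join-worseʳ c)
      (stable⇒wife-preferred join-stable
        (subst (λ h → rkW w c < rkW w h)
          (sym (husband-unique join (join-fixes-rotation exposed p₀∈ w₀-M′-wife q∈))) w-prefers-c))

  module _ {M M′ : Matching I} (M-stable : Stable I M) (M′-stable : Stable I M′)
           {ρ σ} (ρ-exposed : ExposedIn I M ρ) (σ-exposed : ExposedIn I M′ σ)
           {p q q′} (p∈ρ : p ∈ ρ) (p∈σ : p ∈ σ)
           (pq : (p , q) ∈ cyclicPairs ρ) (pq′ : (p , q′) ∈ cyclicPairs σ) where

    private
      M′-matches-p : μ M′ (proj₁ p) ≡ proj₂ p
      M′-matches-p = exposed-matched {M′} σ-exposed p∈σ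

    -- Otherwise w₁ = proj₂ q lies strictly between M′(m) and m's successor in σ, so she prefers her
    -- M′-husband c to m, hence to her M-husband; rival-prefers-M′ then says c prefers M′(c) = w₁ to w₁.
    next-woman-not-earlier : ¬ rkM (proj₁ p) (proj₂ q) < rkM (proj₁ p) (proj₂ q′)
    next-woman-not-earlier before = <-irrefl (cong (rkM c) (μ-husband M′ w₁))
      (rival-prefers-M′ {M} {M′} M-stable M′-stable ρ-exposed p∈ρ M′-matches-p (cyclicPairs-∈ʳ ρ pq)
        (<-trans (IsNext-skipped (exposed-next {M′} σ-exposed pq′) after-M′-wife before) prefers-m))
      where
      m = proj₁ p
      w₁ = proj₂ q
      c = husband M′ w₁
      next : IsNext I M m w₁
      next = exposed-next {M} ρ-exposed pq
      after-M′-wife : rkM m (μ M′ m) < rkM m w₁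
      after-M′-wife = subst (λ w → rkM m w < rkM m w₁)
        (trans (exposed-matched {M} ρ-exposed p∈ρ) (sym M′-matches-p)) (proj₁ next)
      prefers-m : rkW w₁ m < rkW w₁ (proj₁ q)
      prefers-m = subst (λ h → rkW w₁ m < rkW w₁ h) (exposed-husband ρ-exposed (cyclicPairs-∈ʳ ρ pq))
        (PrefersW⇒< M (proj₁ (proj₂ next)))

    next-man-not-preferred : proj₂ q ≡ proj₂ q′ → ¬ rkW (proj₂ q) (proj₁ q′) < rkW (proj₂ q) (proj₁ q)
    next-man-not-preferred same-woman prefers = <-irrefl
      (cong (rkM (proj₁ q′)) (trans (exposed-matched {M′} σ-exposed (cyclicPairs-∈ʳ σ pq′)) (sym same-woman)))
      (rival-prefers-M′ {M} {M′} M-stable M′-stable ρ-exposed p∈ρ M′-matches-p (cyclicPairs-∈ʳ ρ pq) prefers)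

  successor-unique : ∀ {M M′} → Stable I M → Stable I M′ →
    ∀ {ρ σ} → ExposedIn I M ρ → ExposedIn I M′ σ →
    ∀ {p q q′} → p ∈ ρ → p ∈ σ → (p , q) ∈ cyclicPairs ρ → (p , q′) ∈ cyclicPairs σ → q ≡ q′
  successor-unique {M} {M′} M-stable M′-stable ρ-exposed σ-exposed
                   {p} {m₁ , w₁} {m₁′ , w₁′} p∈ρ p∈σ pq pq′ =
    cong₂ _,_ same-man same-woman
    where
    same-woman : w₁ ≡ w₁′
    same-woman = rkM-injective (proj₁ p) (≤-antisym
      (≮⇒≥ (next-woman-not-earlier {M′} {M} M′-stable M-stable σ-exposed ρ-exposed p∈σ p∈ρ pq′ pq))
      (≮⇒≥ (next-woman-not-earlier {M} {M′} M-stable M′-stable ρ-exposed σ-exposed p∈ρ p∈σ pq pq′)))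
    same-man : m₁ ≡ m₁′
    same-man = rkW-injective w₁ (≤-antisym
      (≮⇒≥ (next-man-not-preferred {M} {M′} M-stable M′-stable ρ-exposed σ-exposed p∈ρ p∈σ pq pq′ same-woman))
      (≮⇒≥ (subst (λ w → ¬ rkW w m₁ < rkW w m₁′) (sym same-woman)
        (next-man-not-preferred {M′} {M} M′-stable M-stable σ-exposed ρ-exposed p∈σ p∈ρ pq′ pq (sym same-woman)))))

  IsRotation-sharing⇒CyclicEq : ∀ {ρ σ p} → IsRotation I ρ → IsRotation I σ → p ∈ ρ → p ∈ σ →
    CyclicEq ρ σ
  IsRotation-sharing⇒CyclicEq {ρ} {σ} (M , M-stable , ρ-exposed) (M′ , M′-stable , σ-exposed) p∈ρ p∈σ =
    sameSuccessors⇒CyclicEq (Unique.map⁻ (proj₁ (proj₂ ρ-exposed))) (Unique.map⁻ (proj₁ (proj₂ σ-exposed)))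
      p∈ρ p∈σ
      (λ uv uv′ → successor-unique {M} {M′} M-stable M′-stable ρ-exposed σ-exposed
        (cyclicPairs-∈ˡ ρ uv) (cyclicPairs-∈ˡ σ uv′) uv uv′)

  -- Junk value (the agent itself) when the agent does not occur in the list.
  wifeIn : Fin n → List (Fin n × Fin n) → Fin n
  wifeIn m []            = m
  wifeIn m ((a , b) ∷ ρ) with a Fin.≟ m
  ... | yes _ = b
  ... | no _  = wifeIn m ρ

  wifeIn-∈ : ∀ m ρ → m ∈ map proj₁ ρ → (m , wifeIn m ρ) ∈ ρ
  wifeIn-∈ m ((a , b) ∷ ρ) m∈ with a Fin.≟ m | m∈
  ... | yes refl | _         = here refl
  ... | no a≢m   | here m≡a  = contradiction (sym m≡a) a≢m
  ... | no _     | there m∈′ = there (wifeIn-∈ m ρ m∈′)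

  husbandIn : Fin n → List (Fin n × Fin n) → Fin n
  husbandIn w []            = w
  husbandIn w ((a , b) ∷ ρ) with b Fin.≟ w
  ... | yes _ = a
  ... | no _  = husbandIn w ρ

  husbandIn-∈ : ∀ w ρ → w ∈ map proj₂ ρ → (husbandIn w ρ , w) ∈ ρ
  husbandIn-∈ w ((a , b) ∷ ρ) w∈ with b Fin.≟ w | w∈
  ... | yes refl | _         = here refl
  ... | no b≢w   | here w≡b  = contradiction (sym w≡b) b≢w
  ... | no _     | there w∈′ = there (husbandIn-∈ w ρ w∈′)

  -- Along a rotation each man moves to a woman he ranks lower; with a common list this cannot cycle.
  identical-lists⇒¬IsRotation : (∀ w m m′ → rkM m w ≤ rkM m′ w) → ∀ {ρ} → ¬ IsRotation I ρ
  identical-lists⇒¬IsRotation identical {[]}           (_ , _ , () , _)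
  identical-lists⇒¬IsRotation identical {(m₀ , _) ∷ ρ} (M , _ , exposed) =
    cyclic-¬strictlyIncreasing (λ p → rkM m₀ (proj₂ p)) _ ρ increasing
    where
    increasing : ∀ {u v} → (u , v) ∈ cyclicPairs ((m₀ , _) ∷ ρ) → rkM m₀ (proj₂ u) < rkM m₀ (proj₂ v)
    increasing {m , w} {_ , w′} uv = begin-strict
      rkM m₀ w         ≤⟨ identical w m₀ m ⟩
      rkM m w          ≡⟨ cong (rkM m) (sym (exposed-matched {M} exposed (cyclicPairs-∈ˡ _ uv))) ⟩
      rkM m (μ M m)    <⟨ proj₁ (exposed-next {M} exposed uv) ⟩
      rkM m w′         ≤⟨ identical w′ m m₀ ⟩
      rkM m₀ w′        ∎
      where open ≤-Reasoning

  -- Together the two hypotheses say that range(I) ≤ D + 1.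
  module Spread (D : ℕ)
    (spreadᴹ : ∀ m w w′ → rkW w m ≤ rkW w′ m + D)
    (spreadᵂ : ∀ w m m′ → rkM m w ≤ rkM m′ w + D) where

    rkW-spread-< : ∀ {x y m} v → rkW x y < rkW x m → rkW v y < rkW v m + (D + D)
    rkW-spread-< {x} {y} {m} v lt = begin-strict
      rkW v y          ≤⟨ spreadᴹ y v x ⟩
      rkW x y + D      <⟨ +-monoˡ-< D lt ⟩
      rkW x m + D      ≤⟨ +-monoˡ-≤ D (spreadᴹ m x v) ⟩
      rkW v m + D + D  ≡⟨ +-assoc (rkW v m) D D ⟩
      rkW v m + (D + D) ∎
      where open ≤-Reasoning

    rkM-spread-< : ∀ {z x w} u → rkM z x < rkM z w → rkM u x < rkM u w + (D + D)
    rkM-spread-< {z} {x} {w} u lt = begin-strict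
      rkM u x          ≤⟨ spreadᵂ x u z ⟩
      rkM z x + D      <⟨ +-monoˡ-< D lt ⟩
      rkM z w + D      ≤⟨ +-monoˡ-≤ D (spreadᵂ w z u) ⟩
      rkM u w + D + D  ≡⟨ +-assoc (rkM u w) D D ⟩
      rkM u w + (D + D) ∎
      where open ≤-Reasoning

    -- Every man w prefers to m is matched to a woman he prefers to w, hence ranked near the top by u.
    stable-husband-rank≤ : ∀ {M} → Stable I M → ∀ {m w} → μ M m ≡ w → ∀ u → rkW w m ≤ rkM u w + (D + D)
    stable-husband-rank≤ {M} stable {m} {w} refl u =
      prefix-injection⇒≤ (rankW w) (rankW-inj w) (λ z → rkM u (μ M z)) (<⇒≤ (toℕ<n _))
        (λ z w-prefers-z → rkM-spread-< u (stable⇒wife-preferred stable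
          (subst (λ h → rkW w z < rkW w h) (sym (husband-unique M refl)) w-prefers-z)))
        (λ _ _ eq → μ-inj M (rkM-injective u eq))

    husbands-bound-rank : ∀ N m v {r} → r ≤ n →
      (∀ x → rkM m x < r → rkW v (husband N x) < rkW v m + (D + D)) → r ≤ rkW v m + (D + D)
    husbands-bound-rank N m v r≤n bound =
      prefix-injection⇒≤ (rankM m) (rankM-inj m) (λ x → rkW v (husband N x)) r≤n bound
        (λ {x} {x′} _ _ eq → trans (sym (μ-husband N x)) (trans (cong (μ N) (rkW-injective v eq)) (μ-husband N x′)))

    stable-wife-rank≤ : ∀ {M} → Stable I M → ∀ {m w} → μ M m ≡ w → ∀ v → rkM m w ≤ rkW v m + (D + D)
    stable-wife-rank≤ {M} stable {m} refl v = husbands-bound-rank M m v (<⇒≤ (toℕ<n _))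
      (λ x m-prefers-x → rkW-spread-< v (stable⇒husband-preferred stable m-prefers-x))

    next-wife-rank≤ : ∀ {M} → Stable I M → ∀ {m s} → IsNext I M m s → 0 < D →
      ∀ v → rkM m s ≤ rkW v m + (D + D)
    next-wife-rank≤ {M} stable {m} {s} next 0<D v = husbands-bound-rank M m v (<⇒≤ (toℕ<n _)) bound
      where
      bound : ∀ x → rkM m x < rkM m s → rkW v (husband M x) < rkW v m + (D + D)
      bound x before with <-cmp (rkM m x) (rkM m (μ M m))
      ... | tri< m-prefers-x _ _ = rkW-spread-< v (stable⇒husband-preferred stable m-prefers-x)
      ... | tri≈ _ same _ = subst (λ h → rkW v h < rkW v m + (D + D))
                              (sym (husband-unique M (sym (rkM-injective m same))))
                              (m<m+n (rkW v m) (+-mono-≤ 0<D z≤n))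
      ... | tri> _ _ after = rkW-spread-< v (IsNext-skipped next after before)

    rotation⇒0<D : ∀ {ρ} → IsRotation I ρ → 0 < D
    rotation⇒0<D rotation = n≢0⇒n>0 λ D≡0 → identical-lists⇒¬IsRotation
      (λ w m m′ → subst (rkM m w ≤_) (trans (cong (rkM m′ w +_) D≡0) (+-identityʳ _)) (spreadᵂ w m m′))
      rotation

    rotation-wife-rank< : ∀ {ρ} → IsRotation I ρ → ∀ {m w} → (m , w) ∈ ρ →
      ∀ v → rkM m w < rkW v m + (D + D)
    rotation-wife-rank< {ρ} rotation@(M , stable , exposed) p∈ v with (_ , s) , pq ← cyclic-successor ρ p∈ =
      <-≤-trans (subst (λ x → rkM _ x < rkM _ s) (exposed-matched {M} exposed p∈)
                  (proj₁ (exposed-next {M} exposed pq)))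
                (next-wife-rank≤ {M} stable (exposed-next {M} exposed pq) (rotation⇒0<D rotation) v)

    rotation-husband-rank< : ∀ {ρ} → IsRotation I ρ → ∀ {m w} → (m , w) ∈ ρ →
      ∃ λ d → rkM d w < rkW w m + (D + D)
    rotation-husband-rank< {ρ} rotation@(M , stable , exposed) {m} {w} p∈
      with (d , _) , dp ← cyclic-predecessor ρ p∈ =
      d , ≤-<-trans (next-wife-rank≤ {M} stable (exposed-next {M} exposed dp) (rotation⇒0<D rotation) w)
                    (+-monoˡ-< (D + D) (subst (λ h → rkW w d < rkW w h) (exposed-husband exposed p∈)
                      (PrefersW⇒< M (proj₁ (proj₂ (exposed-next {M} exposed dp))))))

    stable-partners-of-man : ∀ m (ws : List (Fin n)) → Unique ws → All (λ w → StablePartner I m w) ws →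
      length ws ≤ suc ((D + D) + (D + D))
    stable-partners-of-man m ws ws! partners =
      window⇒length≤ (rkM m) _ ws (AllPairs.map (λ w≢ eq → w≢ (rkM-injective m eq)) ws!) close
      where
      close : ∀ {a b} → a ∈ ws → b ∈ ws → rkM m a < rkM m b + suc ((D + D) + (D + D))
      close {a} {b} a∈ b∈
        with (Ma , Ma-stable , a-wife) ← All.lookup partners a∈
           | (Mb , Mb-stable , b-wife) ← All.lookup partners b∈ =
        subst (rkM m a <_) (sym (+-suc (rkM m b) _)) (s≤s (≤-+-trans (rkW b m) (rkM m b) (D + D) (D + D)
          (stable-wife-rank≤ {Ma} Ma-stable a-wife _) (stable-husband-rank≤ {Mb} Mb-stable b-wife m)))

    stable-partners-of-woman : ∀ w (ms : List (Fin n)) → Unique ms → All (λ m → StablePartner I m w) ms →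
      length ms ≤ suc ((D + D) + (D + D))
    stable-partners-of-woman w ms ms! partners =
      window⇒length≤ (rkW w) _ ms (AllPairs.map (λ m≢ eq → m≢ (rkW-injective w eq)) ms!) close
      where
      close : ∀ {a b} → a ∈ ms → b ∈ ms → rkW w a < rkW w b + suc ((D + D) + (D + D))
      close {a} {b} a∈ b∈
        with (Ma , Ma-stable , a-husband) ← All.lookup partners a∈
           | (Mb , Mb-stable , b-husband) ← All.lookup partners b∈ =
        subst (rkW w a <_) (sym (+-suc (rkW w b) _)) (s≤s (≤-+-trans (rkM b w) (rkW w b) (D + D) (D + D)
          (stable-husband-rank≤ {Ma} Ma-stable a-husband _) (stable-wife-rank≤ {Mb} Mb-stable b-husband w)))

    rotations-through-man : ∀ m (ρs : List (List (Fin n × Fin n))) → AllPairs (λ ρ σ → ¬ CyclicEq ρ σ) ρs →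
      All (λ ρ → IsRotation I ρ × m ∈ map proj₁ ρ) ρs → length ρs ≤ (D + D) + (D + D)
    rotations-through-man m ρs inequivalent through =
      window⇒length≤ (λ ρ → rkM m (wifeIn m ρ)) _ ρs (AllPairs-mapWith distinct through inequivalent) close
      where
      distinct : ∀ {ρ σ} → IsRotation I ρ × m ∈ map proj₁ ρ → IsRotation I σ × m ∈ map proj₁ σ →
        ¬ CyclicEq ρ σ → rkM m (wifeIn m ρ) ≢ rkM m (wifeIn m σ)
      distinct {ρ} {σ} (ρ-rotation , m∈ρ) (σ-rotation , m∈σ) ¬cyclic eq = ¬cyclic
        (IsRotation-sharing⇒CyclicEq ρ-rotation σ-rotation (wifeIn-∈ m ρ m∈ρ)
          (subst (λ w → (m , w) ∈ σ) (sym (rkM-injective m eq)) (wifeIn-∈ m σ m∈σ)))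
      close : ∀ {a b} → a ∈ ρs → b ∈ ρs → rkM m (wifeIn m a) < rkM m (wifeIn m b) + ((D + D) + (D + D))
      close {a} {b} a∈ b∈
        with a-rotation , m∈a ← All.lookup through a∈
           | (Mb , Mb-stable , b-exposed) , m∈b ← All.lookup through b∈ =
        ≤-+-trans (rkW (wifeIn m b) m) (rkM m (wifeIn m b)) (D + D) (D + D)
          (rotation-wife-rank< a-rotation (wifeIn-∈ m a m∈a) (wifeIn m b))
          (stable-husband-rank≤ {Mb} Mb-stable (exposed-matched {Mb} b-exposed (wifeIn-∈ m b m∈b)) m)

    rotations-through-woman : ∀ w (ρs : List (List (Fin n × Fin n))) → AllPairs (λ ρ σ → ¬ CyclicEq ρ σ) ρs →
      All (λ ρ → IsRotation I ρ × w ∈ map proj₂ ρ) ρs → length ρs ≤ (D + D) + (D + D)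
    rotations-through-woman w ρs inequivalent through =
      window⇒length≤ (λ ρ → rkW w (husbandIn w ρ)) _ ρs (AllPairs-mapWith distinct through inequivalent) close
      where
      distinct : ∀ {ρ σ} → IsRotation I ρ × w ∈ map proj₂ ρ → IsRotation I σ × w ∈ map proj₂ σ →
        ¬ CyclicEq ρ σ → rkW w (husbandIn w ρ) ≢ rkW w (husbandIn w σ)
      distinct {ρ} {σ} (ρ-rotation , w∈ρ) (σ-rotation , w∈σ) ¬cyclic eq = ¬cyclic
        (IsRotation-sharing⇒CyclicEq ρ-rotation σ-rotation (husbandIn-∈ w ρ w∈ρ)
          (subst (λ m → (m , w) ∈ σ) (sym (rkW-injective w eq)) (husbandIn-∈ w σ w∈σ)))
      close : ∀ {a b} → a ∈ ρs → b ∈ ρs → rkW w (husbandIn w a) < rkW w (husbandIn w b) + ((D + D) + (D + D))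
      close {a} {b} a∈ b∈
        with (Ma , Ma-stable , a-exposed) , w∈a ← All.lookup through a∈
           | b-rotation , w∈b ← All.lookup through b∈
        with d , d-close ← rotation-husband-rank< b-rotation (husbandIn-∈ w b w∈b) =
        ≤-+-trans (suc (rkM d w)) (rkW w (husbandIn w b)) (D + D) (D + D)
          (s≤s (stable-husband-rank≤ {Ma} Ma-stable (exposed-matched {Ma} a-exposed (husbandIn-∈ w a w∈a)) d))
          d-close

∈⇒≤foldr-⊔ : ∀ {x xs} → x ∈ xs → x ≤ foldr _⊔_ 0 xs
∈⇒≤foldr-⊔ {xs = y ∷ _} (here refl) = m≤m⊔n y _
∈⇒≤foldr-⊔ {xs = y ∷ _} (there x∈)  = m≤n⇒m≤o⊔n y (∈⇒≤foldr-⊔ x∈)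

∈⇒foldr-⊓≤ : ∀ {x xs} b → x ∈ xs → foldr _⊓_ b xs ≤ x
∈⇒foldr-⊓≤ {xs = y ∷ _} b (here refl) = m⊓n≤m y _
∈⇒foldr-⊓≤ {xs = y ∷ _} b (there x∈)  = m≤n⇒o⊓m≤n y (∈⇒foldr-⊓≤ b x∈)

between-extremes⇒≤+ : ∀ {a b hi lo D} → a ≤ hi → lo ≤ b → hi ∸ lo ≤ D → a ≤ b + D
between-extremes⇒≤+ {a} {b} a≤hi lo≤b hi∸lo≤D =
  ≤-trans (m≤n+m∸n a b) (+-monoʳ-≤ b (≤-trans (∸-mono a≤hi lo≤b) hi∸lo≤D))

module _ {n : ℕ} (I : Instance n) {D : ℕ} (range≤ : range I ≤ suc D) where

  private
    rank-spreads≤ : ∀ {x} → x ∈ map (λ m → maxRankM I m ∸ minRankM I m) (allFin n)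
                               ++ map (λ w → maxRankW I w ∸ minRankW I w) (allFin n) → x ≤ D
    rank-spreads≤ x∈ = ≤-trans (∈⇒≤foldr-⊔ x∈) (≤-pred (subst (_≤ suc D) (+-comm _ 1) range≤))

  range⇒spreadᴹ : ∀ m w w′ → rkW I w m ≤ rkW I w′ m + D
  range⇒spreadᴹ m w w′ = between-extremes⇒≤+
    (∈⇒≤foldr-⊔ (∈-map⁺ (λ v → rkW I v m) (∈-allFin w)))
    (∈⇒foldr-⊓≤ n (∈-map⁺ (λ v → rkW I v m) (∈-allFin w′)))
    (rank-spreads≤ (∈-++⁺ˡ (∈-map⁺ _ (∈-allFin m))))

  range⇒spreadᵂ : ∀ w m m′ → rkM I m w ≤ rkM I m′ w + D
  range⇒spreadᵂ w m m′ = between-extremes⇒≤+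
    (∈⇒≤foldr-⊔ (∈-map⁺ (λ u → rkM I u w) (∈-allFin m)))
    (∈⇒foldr-⊓≤ n (∈-map⁺ (λ u → rkM I u w) (∈-allFin m′)))
    (rank-spreads≤ (∈-++⁺ʳ _ (∈-map⁺ _ (∈-allFin w))))

4D+1≤5[1+D]∸4 : ∀ D → suc ((D + D) + (D + D)) ≤ 5 * suc D ∸ 4
4D+1≤5[1+D]∸4 D = subst (suc ((D + D) + (D + D)) ≤_)
  (sym (trans (cong (_∸ 4) (five-times D)) (m+n∸n≡m _ 4))) (m≤m+n _ D)
  where
  five-times : ∀ D → 5 * suc D ≡ suc ((D + D) + (D + D)) + D + 4
  five-times = solve-∀

4D≤5[1+D]∸5 : ∀ D → (D + D) + (D + D) ≤ 5 * suc D ∸ 5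
4D≤5[1+D]∸5 D = subst ((D + D) + (D + D) ≤_)
  (sym (trans (cong (_∸ 5) (five-times D)) (m+n∸n≡m _ 5))) (m≤m+n _ D)
  where
  five-times : ∀ D → 5 * suc D ≡ (D + D) + (D + D) + D + 5
  five-times = solve-∀

corollary7p5 : ∀ (n : ℕ) (I : Instance n) (k : ℕ) → range I ≤ k →
    ((m : Fin n) (ws : List (Fin n)) → Unique ws → All (λ w → StablePartner I m w) ws → length ws ≤ 5 * k ∸ 4) ×
    ((w : Fin n) (ms : List (Fin n)) → Unique ms → All (λ m → StablePartner I m w) ms → length ms ≤ 5 * k ∸ 4) ×
    ((m : Fin n) (ρs : List (List (Fin n × Fin n))) → AllPairs (λ ρ σ → ¬ CyclicEq ρ σ) ρs →
      All (λ ρ → IsRotation I ρ × m ∈ map proj₁ ρ) ρs → length ρs ≤ 5 * k ∸ 5) ×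
    ((w : Fin n) (ρs : List (List (Fin n × Fin n))) → AllPairs (λ ρ σ → ¬ CyclicEq ρ σ) ρs →
      All (λ ρ → IsRotation I ρ × w ∈ map proj₂ ρ) ρs → length ρs ≤ 5 * k ∸ 5)
corollary7p5 n I zero    range≤0 = contradiction (subst (_≤ 0) (+-comm _ 1) range≤0) λ ()
corollary7p5 n I (suc D) range≤k =
  (λ m ws ws! partners → ≤-trans (stable-partners-of-man m ws ws! partners) (4D+1≤5[1+D]∸4 D)) ,
  (λ w ms ms! partners → ≤-trans (stable-partners-of-woman w ms ms! partners) (4D+1≤5[1+D]∸4 D)) ,
  (λ m ρs inequivalent through → ≤-trans (rotations-through-man m ρs inequivalent through) (4D≤5[1+D]∸5 D)) ,
  (λ w ρs inequivalent through → ≤-trans (rotations-through-woman w ρs inequivalent through) (4D≤5[1+D]∸5 D))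
  where open Spread I D (range⇒spreadᴹ I range≤k) (range⇒spreadᵂ I range≤k)
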